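{- Let $n\ge1$ and define $D$ on vertices of the freehedron $\mathcal{F}^n$ by $D(v)=a+b-1$, where $v$ is labelled by the triple $(\mathfrak{F},\emptyset,\mathfrak{G})$, $a$ is the number of trees in $\mathfrak{F}$ and $b$ the number of trees in $\mathfrak{G}$. Then $D$ is sup-dimensional: $D(\min\mathcal{F}^n)=n-1$, $D(\max\mathcal{F}^n)=0$, and for every face $F$ of $\mathcal{F}^n$, $D(\min F)-D(\max F)\ge\dim F-1$.
   Context: A short forest is a (possibly empty) sequence of nonempty planar rooted trees of depth 2; the edges at the root are branches and the outer edges (each branch carries at least one) are leaves. A forest-tree-forest triple $(\mathfrak{F},\mathfrak{T},\mathfrak{G})$ consists of a left short forest $\mathfrak{F}$, a middle planar tree $\mathfrak{T}$ of depth 2 (possibly empty, written $\emptyset$), and a right short forest $\mathfrak{G}$. A mid-branch space is a pair of neighbouring branches of the same tree. The dimension of the triple is the number of mid-branch spaces, plus $1$ if $\mathfrak{T}$ is nonempty. Face transformations: (Merge) for a mid-branch space in any tree (including $\mathfrak{T}$), replace the two branches by one branch carrying the leaves of both; (Push apart) for a mid-branch space in a tree of $\mathfrak{F}$ or $\mathfrak{G}$, split that tree into two consecutive trees there; (Move left) move some positive number of leftmost branches of $\mathfrak{T}$ to a new rightmost tree of $\mathfrak{F}$; (Move right) move some positive number of rightmost branches of $\mathfrak{T}$ to a new leftmost tree of $\mathfrak{G}$. The freehedron $\mathcal{F}^n$ is a cell subdivision of the cube $[0,2]^n$ whose faces are (by earlier work) in bijection with forest-tree-forest triples with $n$ leaves,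 with matching dimensions, face inclusion corresponding to obtainability by finite sequences of face transformations, and vertices corresponding to triples of dimension $0$ (empty middle tree, all trees with one branch). For a vertex triple $(\mathfrak{F},\emptyset,\mathfrak{G})$ with leaves labelled right to left $L_1,\dots,L_n$, the vertex has coordinates $v_1=2$ if $\mathfrak{G}\ne\emptyset$ and $0$ otherwise, and for $i>1$: $v_i=2$ if $L_{i-1},L_i$ are on the same tree, $1$ if on different trees of the right forest, $0$ otherwise. For a face $F$, $\min F$ (resp. $\max F$) denotes its unique vertex whose coordinates are coordinatewise $\le$ (resp. $\ge$) those of all vertices of $F$. In particular $\min\mathcal{F}^n$ is labelled by $n$ one-leaf trees in the left forest and $\max\mathcal{F}^n$ by a single tree with one branch carrying all $n$ leaves in the right forest. -}

module Defs where

open import Data.Nat using (ℕ; zero; suc; _+_; _∸_; _≤_; _≡ᵇ_)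
open import Data.Bool using (Bool; true; false; _∧_; if_then_else_)
open import Data.List using (List; []; _∷_; _++_; length; map; replicate; reverse; [_])
open import Data.Nat.ListAction using (sum)
open import Data.List.NonEmpty using (List⁺; toList)
open import Data.List.Relation.Unary.All using (All)
open import Data.List.Relation.Binary.Pointwise using (Pointwise)
open import Data.Product using (_×_; _,_)
open import Data.Integer as ℤ using (ℤ; +_)
open import Relation.Binary.PropositionalEquality using (_≡_)
open import Relation.Binary.Construct.Closure.ReflexiveTransitive using (Star)

-- A branch is encoded by a natural number b; it carries (suc b) leaves
-- (every branch carries at least one leaf).
Branch : Set
Branch = ℕ

leavesB : Branch → ℕ
leavesB b = suc b

-- A (possibly empty) planar rooted tree of depth 2: its list of branches
-- (left to right). Used for the middle tree; [] is the empty tree ∅.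
MTree : Set
MTree = List Branch

Tree : Set
Tree = List⁺ Branch

Forest : Set
Forest = List Tree

record Triple : Set where
  constructor ⟨_,_,_⟩
  field
    left   : Forest
    middle : MTree
    right  : Forest
open Triple public

leavesT : MTree → ℕ
leavesT t = sum (map leavesB t)

leavesF : Forest → ℕ
leavesF f = sum (map (λ t → leavesT (toList t)) f)

leaves : Triple → ℕ
leaves ⟨ f , t , g ⟩ = leavesF f + leavesT t + leavesF g

spacesTree : Tree → ℕ
spacesTree t = length (toList t) ∸ 1

spacesF : Forest → ℕ
spacesF f = sum (map spacesTree f)

-- dimension: mid-branch spaces, plus 1 if the middle tree is nonempty.
-- For the middle tree with k ≥ 1 branches this is (k - 1) + 1 = k; for ∅ it is 0.
dim : Triple → ℕ
dim ⟨ f , t , g ⟩ = spacesF f + length t + spacesF g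

data MergeL : List Branch → List Branch → Set where
  merge : ∀ xs b c ys →
    MergeL (xs ++ b ∷ c ∷ ys) (xs ++ (b + suc c) ∷ ys)   -- leaves: suc b + suc c

data Step : Triple → Triple → Set where
  mergeLeft  : ∀ fs t t' gs m g → MergeL (toList t) (toList t') →
    Step ⟨ fs ++ t ∷ gs , m , g ⟩ ⟨ fs ++ t' ∷ gs , m , g ⟩
  mergeMid   : ∀ f m m' g → MergeL m m' →
    Step ⟨ f , m , g ⟩ ⟨ f , m' , g ⟩
  mergeRight : ∀ f m gs t t' hs → MergeL (toList t) (toList t') →
    Step ⟨ f , m , gs ++ t ∷ hs ⟩ ⟨ f , m , gs ++ t' ∷ hs ⟩
  pushLeft   : ∀ fs t t₁ t₂ gs m g → toList t ≡ toList t₁ ++ toList t₂ →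
    Step ⟨ fs ++ t ∷ gs , m , g ⟩ ⟨ fs ++ t₁ ∷ t₂ ∷ gs , m , g ⟩
  pushRight  : ∀ f m gs t t₁ t₂ hs → toList t ≡ toList t₁ ++ toList t₂ →
    Step ⟨ f , m , gs ++ t ∷ hs ⟩ ⟨ f , m , gs ++ t₁ ∷ t₂ ∷ hs ⟩
  moveLeft   : ∀ f (t₁ : Tree) ys g →
    Step ⟨ f , toList t₁ ++ ys , g ⟩ ⟨ f ++ [ t₁ ] , ys , g ⟩
  moveRight  : ∀ f ys (t₂ : Tree) g →
    Step ⟨ f , ys ++ toList t₂ , g ⟩ ⟨ f , ys , t₂ ∷ g ⟩

_⊒_ : Triple → Triple → Set
F ⊒ G = Star Step F G

oneBranch : Tree → Set
oneBranch t = length (toList t) ≡ 1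

IsVertex : Triple → Set
IsVertex ⟨ f , t , g ⟩ = All oneBranch f × t ≡ [] × All oneBranch g

VertexOf : Triple → Triple → Set
VertexOf F v = IsVertex v × F ⊒ v

-- Coordinates of a vertex.
-- Each leaf is tagged by (side , index of its tree in its forest);
-- side = false for the left forest, true for the right forest.
Tag : Set
Tag = Bool × ℕ

tagsF : Bool → ℕ → Forest → List Tag
tagsF s j [] = []
tagsF s j (t ∷ ts) = replicate (leavesT (toList t)) (s , j) ++ tagsF s (suc j) ts

cmp : Tag → Tag → ℕ
cmp (s , i) (s' , i') =
  if (((s ∧ s') Data.Bool.∨ (Data.Bool.not s ∧ Data.Bool.not s')) ∧ (i ≡ᵇ i')) then 2
  else if (s ∧ s') then 1 else 0
  where import Data.Bool

pairs : List Tag → List ℕ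
pairs [] = []
pairs (x ∷ []) = []
pairs (x ∷ y ∷ rest) = cmp x y ∷ pairs (y ∷ rest)

isEmptyF : Forest → Bool
isEmptyF [] = true
isEmptyF (_ ∷ _) = false

-- coords v = (v₁ , … , vₙ), leaves labelled right to left L₁ … Lₙ.
coords : Triple → List ℕ
coords ⟨ f , t , g ⟩ =
  (if isEmptyF g then 0 else 2) ∷ pairs (reverse (tagsF false 0 f ++ tagsF true 0 g))

_≤c_ : List ℕ → List ℕ → Set
u ≤c v = Pointwise _≤_ u v

IsMinOf : Triple → Triple → Set
IsMinOf F u = VertexOf F u × (∀ v → VertexOf F v → coords u ≤c coords v)

IsMaxOf : Triple → Triple → Set
IsMaxOf F u = VertexOf F u × (∀ v → VertexOf F v → coords v ≤c coords u)

IsMinFn : ℕ → Triple → Set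
IsMinFn n u = IsVertex u × leaves u ≡ n ×
  (∀ v → IsVertex v → leaves v ≡ n → coords u ≤c coords v)

IsMaxFn : ℕ → Triple → Set
IsMaxFn n u = IsVertex u × leaves u ≡ n ×
  (∀ v → IsVertex v → leaves v ≡ n → coords v ≤c coords u)

D : Triple → ℤ
D ⟨ f , t , g ⟩ = (+ length f ℤ.+ + length g) ℤ.- + 1

-- For a vertex, the coordinate v_i (i > 1) is 2 exactly when L_{i-1} and L_i lie on the
-- same tree, so D(v) = a + b - 1 counts the coordinates v_2, ..., v_n different from 2.
-- All coordinates are at most 2, so this count can only drop when coordinates grow:
-- D is antitone on vertices. Every face F contains the vertex obtained by pushing all its
-- trees apart into one-branch trees and moving the middle branches one by one to the left,
-- which has (trees of 𝔉 and 𝔊) + dim F trees, and the vertex obtained by merging every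
-- tree into a single branch and moving the merged middle tree to the right, which has at
-- most one more tree than 𝔉 and 𝔊 together. Comparing min F and max F with these two
-- vertices gives D(min F) - D(max F) ≥ dim F - 1; comparing min 𝓕ⁿ with n one-leaf trees
-- and max 𝓕ⁿ with a single one-branch tree gives the two boundary values.

module Submission where

open import Defs
open import Data.Nat using (ℕ; _≤_)
open import Data.Integer using (ℤ; +_; _-_)
open import Relation.Binary.PropositionalEquality using (_≡_)
open import Data.Product using (_×_)

open import Function using (_∘_)
open import Data.Bool using (true; false; _∧_; _∨_; not; if_then_else_)
open import Data.Nat using (zero; suc; _+_; _∸_; _≡ᵇ_; z≤n; s≤s)
open import Data.Nat.Properties
  using (≤-refl; ≤-reflexive; ≤-trans; +-mono-≤; +-suc; +-comm; +-identityʳ; n≤1+n; m≤n+m;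
         m≤n⇒m≤o+n; m≤n⇒m≤n+o; module ≤-Reasoning)
open import Data.Nat.ListAction using (sum)
open import Data.Nat.Tactic.RingSolver using (solve-∀)
open import Data.Integer using (_⊖_)
import Data.Integer as ℤ
import Data.Integer.Properties as ℤ
open import Data.Integer.Tactic.RingSolver renaming (solve-∀ to ℤ-solve-∀)
open import Data.List
  using (List; []; _∷_; [_]; _++_; length; map; concatMap; replicate; reverse; _ʳ++_)
open import Data.List.Properties
  using (++-assoc; ++-identityʳ; concatMap-pure; concatMap-map; length-++; length-map; length-replicate)
open import Data.List.NonEmpty as List⁺ using (toList) renaming (_∷_ to _∷⁺_; [_] to [_]⁺)
open import Data.List.Relation.Unary.All using (All; []; _∷_; universal)
open import Data.List.Relation.Unary.All.Properties using (map⁺; ++⁺; concat⁺; replicate⁺)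
open import Data.List.Relation.Binary.Pointwise using (Pointwise; []; _∷_)
open import Data.Product using (_,_)
open import Relation.Binary.PropositionalEquality
  using (refl; sym; trans; cong; cong₂; subst; subst₂; module ≡-Reasoning)
open import Relation.Binary.Construct.Closure.ReflexiveTransitive using (ε; _◅_; _◅◅_)

boundary : ℕ → ℕ
boundary 2 = 0
boundary _ = 1

boundaries : List ℕ → ℕ
boundaries = sum ∘ map boundary

boundary-antitone : ∀ {x y} → x ≤ y → y ≤ 2 → boundary y ≤ boundary x
boundary-antitone {y = 2} _ _ = z≤n
boundary-antitone {0} {0} _ _ = ≤-refl
boundary-antitone {0} {1} _ _ = ≤-refl
boundary-antitone {1} {1} _ _ = ≤-refl
boundary-antitone {suc (suc _)} {0} () _
boundary-antitone {suc (suc _)} {1} (s≤s ()) _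
boundary-antitone {y = suc (suc (suc _))} _ (s≤s (s≤s ()))

boundaries-antitone : ∀ {xs ys} → Pointwise _≤_ xs ys → All (_≤ 2) ys → boundaries ys ≤ boundaries xs
boundaries-antitone [] [] = z≤n
boundaries-antitone (x≤y ∷ xs≤ys) (y≤2 ∷ ys≤2) =
  +-mono-≤ (boundary-antitone x≤y y≤2) (boundaries-antitone xs≤ys ys≤2)

cmp≤2 : ∀ x y → cmp x y ≤ 2
cmp≤2 (s , i) (s' , i') = if≤2 ((s ∧ s' ∨ not s ∧ not s') ∧ (i ≡ᵇ i')) (s ∧ s')
  where
  if≤2 : ∀ c d → (if c then 2 else if d then 1 else 0) ≤ 2
  if≤2 true  _     = ≤-refl
  if≤2 false true  = s≤s z≤n
  if≤2 false false = z≤n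

pairs≤2 : ∀ xs → All (_≤ 2) (pairs xs)
pairs≤2 []           = []
pairs≤2 (_ ∷ [])     = []
pairs≤2 (x ∷ y ∷ xs) = cmp≤2 x y ∷ pairs≤2 (y ∷ xs)

≡ᵇ-sym : ∀ i j → (i ≡ᵇ j) ≡ (j ≡ᵇ i)
≡ᵇ-sym zero    zero    = refl
≡ᵇ-sym zero    (suc j) = refl
≡ᵇ-sym (suc i) zero    = refl
≡ᵇ-sym (suc i) (suc j) = ≡ᵇ-sym i j

≡ᵇ-refl : ∀ i → (i ≡ᵇ i) ≡ true
≡ᵇ-refl zero    = refl
≡ᵇ-refl (suc i) = ≡ᵇ-refl i

≡ᵇ-suc : ∀ i → (i ≡ᵇ suc i) ≡ false
≡ᵇ-suc zero    = refl
≡ᵇ-suc (suc i) = ≡ᵇ-suc i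

cmp-sym : ∀ x y → cmp x y ≡ cmp y x
cmp-sym (false , i) (false , j) rewrite ≡ᵇ-sym i j = refl
cmp-sym (false , i) (true  , j) = refl
cmp-sym (true  , i) (false , j) = refl
cmp-sym (true  , i) (true  , j) rewrite ≡ᵇ-sym i j = refl

cmp-refl : ∀ x → cmp x x ≡ 2
cmp-refl (false , i) rewrite ≡ᵇ-refl i = refl
cmp-refl (true  , i) rewrite ≡ᵇ-refl i = refl

cut : Tag → Tag → ℕ
cut x y = boundary (cmp x y)

cut-sym : ∀ x y → cut x y ≡ cut y x
cut-sym x y = cong boundary (cmp-sym x y)

cut-suc : ∀ s j → cut (s , j) (s , suc j) ≡ 1
cut-suc false j rewrite ≡ᵇ-suc j = refl
cut-suc true  j rewrite ≡ᵇ-suc j = refl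

changes : List Tag → ℕ
changes = boundaries ∘ pairs

headCut : List Tag → List Tag → ℕ
headCut (x ∷ _) (y ∷ _) = cut x y
headCut _       _       = 0

changes-∷ : ∀ x ys → changes (x ∷ ys) ≡ headCut (x ∷ []) ys + changes ys
changes-∷ x []      = refl
changes-∷ x (y ∷ _) = refl

headCut-head : ∀ {x zs} ys → headCut (x ∷ []) ys ≡ headCut (x ∷ zs) ys
headCut-head []      = refl
headCut-head (_ ∷ _) = refl

-- In xs ʳ++ ys = reverse xs ++ ys the heads of xs and ys are adjacent.
changes-ʳ++ : ∀ xs ys → changes (xs ʳ++ ys) ≡ changes xs + changes ys + headCut xs ys
changes-ʳ++ []       ys = sym (+-identityʳ (changes ys))
changes-ʳ++ (x ∷ xs) ys = begin
    changes (xs ʳ++ (x ∷ ys))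
  ≡⟨ changes-ʳ++ xs (x ∷ ys) ⟩
    changes xs + changes (x ∷ ys) + headCut xs (x ∷ ys)
  ≡⟨ cong₂ (λ a b → changes xs + a + b) (changes-∷ x ys) (junction xs) ⟩
    changes xs + (headCut (x ∷ []) ys + changes ys) + headCut (x ∷ []) xs
  ≡⟨ shuffle (changes xs) (headCut (x ∷ []) ys) (changes ys) (headCut (x ∷ []) xs) ⟩
    (headCut (x ∷ []) xs + changes xs) + changes ys + headCut (x ∷ []) ys
  ≡⟨ cong₂ (λ a b → a + changes ys + b) (sym (changes-∷ x xs)) (headCut-head ys) ⟩
    changes (x ∷ xs) + changes ys + headCut (x ∷ xs) ys
  ∎
  where
  open ≡-Reasoning
  junction : ∀ zs → headCut zs (x ∷ ys) ≡ headCut (x ∷ []) zs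
  junction []      = refl
  junction (z ∷ _) = cut-sym z x
  shuffle : ∀ a b c d → a + (b + c) + d ≡ d + a + c + b
  shuffle = solve-∀

changes-reverse : ∀ xs → changes (reverse xs) ≡ changes xs
changes-reverse xs = begin
    changes (xs ʳ++ [])
  ≡⟨ changes-ʳ++ xs [] ⟩
    changes xs + 0 + headCut xs []
  ≡⟨ cong (λ c → changes xs + 0 + c) (noCut xs) ⟩
    changes xs + 0 + 0
  ≡⟨ trans (+-identityʳ _) (+-identityʳ _) ⟩
    changes xs
  ∎
  where
  open ≡-Reasoning
  noCut : ∀ zs → headCut zs [] ≡ 0
  noCut []      = refl
  noCut (_ ∷ _) = refl

changes-replicate : ∀ x m xs → changes (x ∷ replicate m x ++ xs) ≡ changes (x ∷ xs)
changes-replicate x zero    xs = refl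
changes-replicate x (suc m) xs rewrite cmp-refl x = changes-replicate x m xs

changes-block : ∀ x m xs ys → changes (x ∷ (replicate m x ++ xs) ++ ys) ≡ changes (x ∷ xs ++ ys)
changes-block x m xs ys =
  trans (cong (changes ∘ (x ∷_)) (++-assoc (replicate m x) xs ys)) (changes-replicate x m (xs ++ ys))

changes-tagsF-right : ∀ j g → changes ((true , j) ∷ tagsF true (suc j) g) ≡ length g
changes-tagsF-right j []                = refl
changes-tagsF-right j ((b ∷⁺ bs) ∷ ts) =
  cong₂ _+_ (cut-suc true j)
    (trans (changes-replicate (true , suc j) (b + leavesT bs) (tagsF true (suc (suc j)) ts))
           (changes-tagsF-right (suc j) ts))

changes-tagsF-left : ∀ j f g →
  changes ((false , j) ∷ tagsF false (suc j) f ++ tagsF true 0 g) ≡ length f + length g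
changes-tagsF-left j [] []                = refl
changes-tagsF-left j [] ((b ∷⁺ bs) ∷ ts) =
  cong suc (trans (changes-replicate (true , 0) (b + leavesT bs) (tagsF true 1 ts))
                  (changes-tagsF-right 0 ts))
changes-tagsF-left j ((b ∷⁺ bs) ∷ ts) g =
  cong₂ _+_ (cut-suc false j)
    (trans (changes-block (false , suc j) (b + leavesT bs) (tagsF false (suc (suc j)) ts) (tagsF true 0 g))
           (changes-tagsF-left (suc j) ts g))

tags : Triple → List Tag
tags v = tagsF false 0 (left v) ++ tagsF true 0 (right v)

treeCount : Triple → ℕ
treeCount v = length (left v) + length (right v)

changes-tags : ∀ v → changes (tags v) ≡ treeCount v ∸ 1
changes-tags ⟨ [] , _ , [] ⟩                = refl
changes-tags ⟨ [] , _ , (b ∷⁺ bs) ∷ ts ⟩    =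
  trans (changes-replicate (true , 0) (b + leavesT bs) (tagsF true 1 ts)) (changes-tagsF-right 0 ts)
changes-tags ⟨ (b ∷⁺ bs) ∷ ts , _ , g ⟩     =
  trans (changes-block (false , 0) (b + leavesT bs) (tagsF false 1 ts) (tagsF true 0 g))
        (changes-tagsF-left 0 ts g)

innerCoords : Triple → List ℕ
innerCoords v = pairs (reverse (tags v))

boundaries-innerCoords : ∀ v → boundaries (innerCoords v) ≡ treeCount v ∸ 1
boundaries-innerCoords v = trans (changes-reverse (tags v)) (changes-tags v)

-1+≤∸1 : ∀ t → + t - + 1 ℤ.≤ + (t ∸ 1)
-1+≤∸1 zero    = ℤ.-≤+
-1+≤∸1 (suc t) = ℤ.≤-reflexive (ℤ.m-n≡m⊖n (suc t) 1)

-1+≡∸1 : ∀ t → 1 ≤ t → + t - + 1 ≡ + (t ∸ 1)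
-1+≡∸1 (suc t) _ = ℤ.m-n≡m⊖n (suc t) 1

D≤boundaries : ∀ v → D v ℤ.≤ + boundaries (innerCoords v)
D≤boundaries v rewrite boundaries-innerCoords v = -1+≤∸1 (treeCount v)

D≡boundaries : ∀ v → 1 ≤ treeCount v → D v ≡ + boundaries (innerCoords v)
D≡boundaries v v≢∅ rewrite boundaries-innerCoords v = -1+≡∸1 (treeCount v) v≢∅

-- The hypothesis is needed because the empty triple has D = -1 but no coordinates to count.
D-antitone : ∀ u v → 1 ≤ treeCount u → coords u ≤c coords v → D v ℤ.≤ D u
D-antitone u v u≢∅ (_ ∷ inner≤) = begin
  D v                            ≤⟨ D≤boundaries v ⟩
  + boundaries (innerCoords v)   ≤⟨ ℤ.+≤+ (boundaries-antitone inner≤ (pairs≤2 (reverse (tags v)))) ⟩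
  + boundaries (innerCoords u)   ≡⟨ sym (D≡boundaries u u≢∅) ⟩
  D u                            ∎
  where open ℤ.≤-Reasoning

data NonEmpty : Triple → Set where
  left⁺   : ∀ {f m g} → 1 ≤ length f → NonEmpty ⟨ f , m , g ⟩
  middle⁺ : ∀ {f m g} → 1 ≤ length m → NonEmpty ⟨ f , m , g ⟩
  right⁺  : ∀ {f m g} → 1 ≤ length g → NonEmpty ⟨ f , m , g ⟩

1≤length-++-∷ : ∀ {A : Set} (xs : List A) {y ys} → 1 ≤ length (xs ++ y ∷ ys)
1≤length-++-∷ []      = s≤s z≤n
1≤length-++-∷ (_ ∷ _) = s≤s z≤n

Step⇒nonEmpty : ∀ {u v} → Step u v → NonEmpty v
Step⇒nonEmpty (mergeLeft fs _ _ _ _ _ _)          = left⁺ (1≤length-++-∷ fs)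
Step⇒nonEmpty (mergeMid _ _ _ _ (merge xs _ _ _)) = middle⁺ (1≤length-++-∷ xs)
Step⇒nonEmpty (mergeRight _ _ gs _ _ _ _)         = right⁺ (1≤length-++-∷ gs)
Step⇒nonEmpty (pushLeft fs _ _ _ _ _ _ _)         = left⁺ (1≤length-++-∷ fs)
Step⇒nonEmpty (pushRight _ _ gs _ _ _ _ _)        = right⁺ (1≤length-++-∷ gs)
Step⇒nonEmpty (moveLeft f _ _ _)                  = left⁺ (1≤length-++-∷ f)
Step⇒nonEmpty (moveRight _ _ _ _)                 = right⁺ (s≤s z≤n)

⊒-nonEmpty : ∀ {u v} → u ⊒ v → NonEmpty u → NonEmpty v
⊒-nonEmpty ε        p = p
⊒-nonEmpty (s ◅ ss) _ = ⊒-nonEmpty ss (Step⇒nonEmpty s)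

leaves⇒nonEmpty : ∀ v → 1 ≤ leaves v → NonEmpty v
leaves⇒nonEmpty ⟨ _ ∷ _ , _     , _     ⟩ _ = left⁺ (s≤s z≤n)
leaves⇒nonEmpty ⟨ []    , _ ∷ _ , _     ⟩ _ = middle⁺ (s≤s z≤n)
leaves⇒nonEmpty ⟨ []    , []    , _ ∷ _ ⟩ _ = right⁺ (s≤s z≤n)
leaves⇒nonEmpty ⟨ []    , []    , []    ⟩ ()

vertex⇒1≤treeCount : ∀ v → IsVertex v → NonEmpty v → 1 ≤ treeCount v
vertex⇒1≤treeCount ⟨ _ , .[] , g ⟩ (_ , refl , _) (left⁺ p) = m≤n⇒m≤n+o (length g) p
vertex⇒1≤treeCount ⟨ f , .[] , _ ⟩ (_ , refl , _) (right⁺ p) = m≤n⇒m≤o+n (length f) p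

length≤leavesF : ∀ f → length f ≤ leavesF f
length≤leavesF []       = z≤n
length≤leavesF (_ ∷ ts) = s≤s (≤-trans (length≤leavesF ts) (m≤n+m _ _))

treeCount≤leaves : ∀ v → treeCount v ≤ leaves v
treeCount≤leaves ⟨ f , m , g ⟩ =
  +-mono-≤ (m≤n⇒m≤n+o (leavesT m) (length≤leavesF f)) (length≤leavesF g)

splitTree : Tree → Forest
splitTree t = map [_]⁺ (toList t)

splitForest : Forest → Forest
splitForest = concatMap splitTree

fuse : Branch → List Branch → Branch
fuse b []       = b
fuse b (c ∷ cs) = fuse (b + suc c) cs

fuseTree : Tree → Tree
fuseTree t = [ fuse (List⁺.head t) (List⁺.tail t) ]⁺

fuseMiddle : MTree → Forest
fuseMiddle []       = []
fuseMiddle (b ∷ bs) = [ fuse b bs ]⁺ ∷ []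

finest : Triple → Triple
finest ⟨ f , m , g ⟩ = ⟨ splitForest f ++ map [_]⁺ m , [] , splitForest g ⟩

coarsest : Triple → Triple
coarsest ⟨ f , m , g ⟩ = ⟨ map fuseTree f , [] , fuseMiddle m ++ map fuseTree g ⟩

module _ (ctx : Forest → Triple) where

  ⊒-concatMap : (h : Tree → Forest) → (∀ fs t gs → ctx (fs ++ t ∷ gs) ⊒ ctx (fs ++ h t ++ gs)) →
                ∀ fs f → ctx (fs ++ f) ⊒ ctx (fs ++ concatMap h f)
  ⊒-concatMap h step fs []       = ε
  ⊒-concatMap h step fs (t ∷ ts) =
    step fs t ts ◅◅ subst₂ _⊒_ (cong ctx (++-assoc fs (h t) ts))
                               (cong ctx (++-assoc fs (h t) (concatMap h ts)))
                               (⊒-concatMap h step (fs ++ h t) ts)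

  ⊒-splitTree : (∀ fs b c cs gs →
                  Step (ctx (fs ++ (b ∷⁺ c ∷ cs) ∷ gs)) (ctx (fs ++ [ b ]⁺ ∷ (c ∷⁺ cs) ∷ gs))) →
                ∀ fs b bs gs → ctx (fs ++ (b ∷⁺ bs) ∷ gs) ⊒ ctx (fs ++ splitTree (b ∷⁺ bs) ++ gs)
  ⊒-splitTree push fs b []       gs = ε
  ⊒-splitTree push fs b (c ∷ cs) gs =
    push fs b c cs gs ◅ subst₂ _⊒_ (cong ctx (++-assoc fs _ ((c ∷⁺ cs) ∷ gs)))
                                   (cong ctx (++-assoc fs _ (splitTree (c ∷⁺ cs) ++ gs)))
                                   (⊒-splitTree push (fs ++ [ b ]⁺ ∷ []) c cs gs)

⊒-fuse : (tctx : Tree → Triple) → (∀ b c cs → Step (tctx (b ∷⁺ c ∷ cs)) (tctx (b + suc c ∷⁺ cs))) →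
         ∀ b bs → tctx (b ∷⁺ bs) ⊒ tctx (fuseTree (b ∷⁺ bs))
⊒-fuse tctx merge-step b []       = ε
⊒-fuse tctx merge-step b (c ∷ cs) = merge-step b c cs ◅ ⊒-fuse tctx merge-step (b + suc c) cs

⊒-splitForest-left : ∀ f m g → ⟨ f , m , g ⟩ ⊒ ⟨ splitForest f , m , g ⟩
⊒-splitForest-left f m g =
  ⊒-concatMap ctx splitTree (λ fs t → ⊒-splitTree ctx push fs (List⁺.head t) (List⁺.tail t)) [] f
  where
  ctx = λ h → ⟨ h , m , g ⟩
  push = λ fs b c cs gs → pushLeft fs (b ∷⁺ c ∷ cs) [ b ]⁺ (c ∷⁺ cs) gs m g refl

⊒-splitForest-right : ∀ f m g → ⟨ f , m , g ⟩ ⊒ ⟨ f , m , splitForest g ⟩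
⊒-splitForest-right f m g =
  ⊒-concatMap ctx splitTree (λ gs t → ⊒-splitTree ctx push gs (List⁺.head t) (List⁺.tail t)) [] g
  where
  ctx = λ h → ⟨ f , m , h ⟩
  push = λ gs b c cs hs → pushRight f m gs (b ∷⁺ c ∷ cs) [ b ]⁺ (c ∷⁺ cs) hs refl

map≡concatMap : ∀ {A B : Set} (h : A → B) xs → map h xs ≡ concatMap (λ x → h x ∷ []) xs
map≡concatMap h xs = trans (sym (concatMap-pure (map h xs))) (concatMap-map [_] h xs)

⊒-fuseForest-left : ∀ f m g → ⟨ f , m , g ⟩ ⊒ ⟨ map fuseTree f , m , g ⟩
⊒-fuseForest-left f m g =
  subst (λ h → ⟨ f , m , g ⟩ ⊒ ⟨ h , m , g ⟩) (sym (map≡concatMap fuseTree f))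
    (⊒-concatMap ctx (λ t → fuseTree t ∷ []) fuseIn [] f)
  where
  ctx = λ h → ⟨ h , m , g ⟩
  fuseIn : ∀ fs t gs → ctx (fs ++ t ∷ gs) ⊒ ctx (fs ++ fuseTree t ∷ gs)
  fuseIn fs t gs = ⊒-fuse (λ t → ctx (fs ++ t ∷ gs))
    (λ b c cs → mergeLeft fs _ _ gs m g (merge [] b c cs)) (List⁺.head t) (List⁺.tail t)

⊒-fuseForest-right : ∀ f m g → ⟨ f , m , g ⟩ ⊒ ⟨ f , m , map fuseTree g ⟩
⊒-fuseForest-right f m g =
  subst (λ h → ⟨ f , m , g ⟩ ⊒ ⟨ f , m , h ⟩) (sym (map≡concatMap fuseTree g))
    (⊒-concatMap ctx (λ t → fuseTree t ∷ []) fuseIn [] g)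
  where
  ctx = λ h → ⟨ f , m , h ⟩
  fuseIn : ∀ gs t hs → ctx (gs ++ t ∷ hs) ⊒ ctx (gs ++ fuseTree t ∷ hs)
  fuseIn gs t hs = ⊒-fuse (λ t → ctx (gs ++ t ∷ hs))
    (λ b c cs → mergeRight f m gs _ _ hs (merge [] b c cs)) (List⁺.head t) (List⁺.tail t)

⊒-moveMiddle-left : ∀ f m g → ⟨ f , m , g ⟩ ⊒ ⟨ f ++ map [_]⁺ m , [] , g ⟩
⊒-moveMiddle-left f []       g = subst (λ h → ⟨ f , [] , g ⟩ ⊒ ⟨ h , [] , g ⟩) (sym (++-identityʳ f)) ε
⊒-moveMiddle-left f (b ∷ bs) g =
  moveLeft f [ b ]⁺ bs g ◅ subst (λ h → ⟨ f ++ [ b ]⁺ ∷ [] , bs , g ⟩ ⊒ ⟨ h , [] , g ⟩)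
                                 (++-assoc f _ (map [_]⁺ bs))
                                 (⊒-moveMiddle-left (f ++ [ b ]⁺ ∷ []) bs g)

⊒-fuseMiddle-right : ∀ f m g → ⟨ f , m , g ⟩ ⊒ ⟨ f , [] , fuseMiddle m ++ g ⟩
⊒-fuseMiddle-right f []       g = ε
⊒-fuseMiddle-right f (b ∷ bs) g =
  ⊒-fuse (λ t → ⟨ f , toList t , g ⟩) (λ b c cs → mergeMid f _ _ g (merge [] b c cs)) b bs
  ◅◅ moveRight f [] [ fuse b bs ]⁺ g ◅ ε

⊒-finest : ∀ F → F ⊒ finest F
⊒-finest ⟨ f , m , g ⟩ =
  ⊒-splitForest-left f m g
  ◅◅ ⊒-moveMiddle-left (splitForest f) m g
  ◅◅ ⊒-splitForest-right (splitForest f ++ map [_]⁺ m) [] g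

⊒-coarsest : ∀ F → F ⊒ coarsest F
⊒-coarsest ⟨ f , m , g ⟩ =
  ⊒-fuseForest-left f m g
  ◅◅ ⊒-fuseForest-right (map fuseTree f) m g
  ◅◅ ⊒-fuseMiddle-right (map fuseTree f) m (map fuseTree g)

oneBranch-map-[_]⁺ : ∀ bs → All oneBranch (map [_]⁺ bs)
oneBranch-map-[_]⁺ bs = map⁺ (universal (λ _ → refl) bs)

oneBranch-splitForest : ∀ f → All oneBranch (splitForest f)
oneBranch-splitForest f = concat⁺ (map⁺ (universal (oneBranch-map-[_]⁺ ∘ toList) f))

finest-isVertex : ∀ F → IsVertex (finest F)
finest-isVertex ⟨ f , m , g ⟩ =
  ++⁺ (oneBranch-splitForest f) (oneBranch-map-[_]⁺ m) , refl , oneBranch-splitForest g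

coarsest-isVertex : ∀ F → IsVertex (coarsest F)
coarsest-isVertex ⟨ f , m , g ⟩ = fused f , refl , ++⁺ (fusedMiddle m) (fused g)
  where
  fused : ∀ f → All oneBranch (map fuseTree f)
  fused f = map⁺ (universal (λ _ → refl) f)
  fusedMiddle : ∀ m → All oneBranch (fuseMiddle m)
  fusedMiddle []      = []
  fusedMiddle (_ ∷ _) = refl ∷ []

length-splitForest : ∀ f → length (splitForest f) ≡ length f + spacesF f
length-splitForest []       = refl
length-splitForest (t ∷ ts) = begin
  length (splitTree t ++ splitForest ts)             ≡⟨ length-++ (splitTree t) ⟩
  length (splitTree t) + length (splitForest ts)     ≡⟨ cong₂ _+_ (length-map [_]⁺ (toList t)) (length-splitForest ts) ⟩
  suc (spacesTree t) + (length ts + spacesF ts)      ≡⟨ shuffle (spacesTree t) (length ts) (spacesF ts) ⟩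
  suc (length ts) + (spacesTree t + spacesF ts)      ∎
  where
  open ≡-Reasoning
  shuffle : ∀ a b c → suc a + (b + c) ≡ suc b + (a + c)
  shuffle = solve-∀

treeCount-finest : ∀ F → treeCount (finest F) ≡ treeCount F + dim F
treeCount-finest ⟨ f , m , g ⟩ = begin
  length (splitForest f ++ map [_]⁺ m) + length (splitForest g)
    ≡⟨ cong₂ _+_ (length-++ (splitForest f)) (length-splitForest g) ⟩
  length (splitForest f) + length (map [_]⁺ m) + (length g + spacesF g)
    ≡⟨ cong₂ (λ a b → a + b + (length g + spacesF g)) (length-splitForest f) (length-map [_]⁺ m) ⟩
  length f + spacesF f + length m + (length g + spacesF g)
    ≡⟨ shuffle (length f) (spacesF f) (length m) (length g) (spacesF g) ⟩
  length f + length g + (spacesF f + length m + spacesF g)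
    ∎
  where
  open ≡-Reasoning
  shuffle : ∀ a b c d e → a + b + c + (d + e) ≡ a + d + (b + c + e)
  shuffle = solve-∀

length-fuseMiddle-++ : ∀ m (xs : Forest) → length (fuseMiddle m ++ xs) ≤ 1 + length xs
length-fuseMiddle-++ []      xs = n≤1+n (length xs)
length-fuseMiddle-++ (_ ∷ _) xs = ≤-refl

treeCount-coarsest : ∀ F → treeCount (coarsest F) ≤ treeCount F + 1
treeCount-coarsest ⟨ f , m , g ⟩ = begin
  length (map fuseTree f) + length (fuseMiddle m ++ map fuseTree g)
    ≤⟨ +-mono-≤ (≤-reflexive (length-map fuseTree f)) (length-fuseMiddle-++ m (map fuseTree g)) ⟩
  length f + suc (length (map fuseTree g))
    ≡⟨ cong (λ k → length f + suc k) (length-map fuseTree g) ⟩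
  length f + suc (length g)
    ≡⟨ trans (+-suc (length f) (length g)) (+-comm 1 (length f + length g)) ⟩
  length f + length g + 1
    ∎
  where open ≤-Reasoning

D-difference : ∀ u v → D u - D v ≡ + treeCount u - + treeCount v
D-difference u v = cancel (+ treeCount u) (+ treeCount v)
  where
  cancel : ∀ (x y : ℤ) → (x - + 1) - (y - + 1) ≡ x - y
  cancel = ℤ-solve-∀

finest-coarsest-gap : ∀ F → + dim F - + 1 ℤ.≤ D (finest F) - D (coarsest F)
finest-coarsest-gap F = begin
  + dim F - + 1
    ≡⟨ ℤ.m-n≡m⊖n (dim F) 1 ⟩
  dim F ⊖ 1
    ≡⟨ sym (ℤ.+-cancelˡ-⊖ L (dim F) 1) ⟩
  (L + dim F) ⊖ (L + 1)
    ≤⟨ ℤ.⊖-monoʳ-≥-≤ (L + dim F) (treeCount-coarsest F) ⟩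
  (L + dim F) ⊖ treeCount (coarsest F)
    ≡⟨ cong (_⊖ treeCount (coarsest F)) (sym (treeCount-finest F)) ⟩
  treeCount (finest F) ⊖ treeCount (coarsest F)
    ≡⟨ sym (ℤ.m-n≡m⊖n (treeCount (finest F)) (treeCount (coarsest F))) ⟩
  + treeCount (finest F) - + treeCount (coarsest F)
    ≡⟨ sym (D-difference (finest F) (coarsest F)) ⟩
  D (finest F) - D (coarsest F)
    ∎
  where
  open ℤ.≤-Reasoning
  L = treeCount F

vertexOf⇒1≤treeCount : ∀ {F v} → 1 ≤ leaves F → VertexOf F v → 1 ≤ treeCount v
vertexOf⇒1≤treeCount {F} {v} F≢∅ (v-vertex , F⊒v) =
  vertex⇒1≤treeCount v v-vertex (⊒-nonEmpty F⊒v (leaves⇒nonEmpty F F≢∅))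

D-dimension-bound : ∀ F → 1 ≤ leaves F → ∀ u w → IsMinOf F u → IsMaxOf F w →
                    + dim F - + 1 ℤ.≤ D u - D w
D-dimension-bound F F≢∅ u w (u∈F , u-min) (w∈F , w-max) = begin
  + dim F - + 1                    ≤⟨ finest-coarsest-gap F ⟩
  D (finest F) - D (coarsest F)    ≤⟨ ℤ.+-mono-≤ finest≤u (ℤ.neg-mono-≤ w≤coarsest) ⟩
  D u - D w                        ∎
  where
  open ℤ.≤-Reasoning
  finest∈F   = finest-isVertex F , ⊒-finest F
  coarsest∈F = coarsest-isVertex F , ⊒-coarsest F
  finest≤u : D (finest F) ℤ.≤ D u
  finest≤u = D-antitone u (finest F) (vertexOf⇒1≤treeCount F≢∅ u∈F) (u-min (finest F) finest∈F)
  w≤coarsest : D w ℤ.≤ D (coarsest F)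
  w≤coarsest =
    D-antitone (coarsest F) w (vertexOf⇒1≤treeCount F≢∅ coarsest∈F) (w-max (coarsest F) coarsest∈F)

leavesF-replicate : ∀ n → leavesF (replicate n [ 0 ]⁺) ≡ n
leavesF-replicate zero    = refl
leavesF-replicate (suc n) = cong suc (leavesF-replicate n)

D-min : ∀ n → 1 ≤ n → ∀ u → IsMinFn n u → D u ≡ + n - + 1
D-min n 1≤n u (u-vertex , u-leaves , u-min) = ℤ.≤-antisym upper lower
  where
  singletons : Triple
  singletons = ⟨ replicate n [ 0 ]⁺ , [] , [] ⟩
  singletons-leaves : leaves singletons ≡ n
  singletons-leaves = trans (+-identityʳ _) (trans (+-identityʳ _) (leavesF-replicate n))
  D-singletons : D singletons ≡ + n - + 1
  D-singletons = cong (λ k → + k - + 1) (trans (+-identityʳ _) (length-replicate n))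
  u≢∅ : 1 ≤ treeCount u
  u≢∅ = vertexOf⇒1≤treeCount (subst (1 ≤_) (sym u-leaves) 1≤n) (u-vertex , ε)
  upper : D u ℤ.≤ + n - + 1
  upper = ℤ.+-monoˡ-≤ (ℤ.- + 1) (ℤ.+≤+ (subst (treeCount u ≤_) u-leaves (treeCount≤leaves u)))
  lower : + n - + 1 ℤ.≤ D u
  lower = subst (ℤ._≤ D u) D-singletons
    (D-antitone u singletons u≢∅ (u-min singletons (replicate⁺ n refl , refl , []) singletons-leaves))

D-max : ∀ n → 1 ≤ n → ∀ w → IsMaxFn n w → D w ≡ + 0
D-max (suc k) 1≤n w (w-vertex , w-leaves , w-max) = ℤ.≤-antisym upper lower
  where
  oneTree : Triple
  oneTree = ⟨ [] , [] , [ k ]⁺ ∷ [] ⟩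
  oneTree-leaves : leaves oneTree ≡ suc k
  oneTree-leaves = cong suc (trans (+-identityʳ _) (+-identityʳ _))
  w≢∅ : 1 ≤ treeCount w
  w≢∅ = vertexOf⇒1≤treeCount (subst (1 ≤_) (sym w-leaves) 1≤n) (w-vertex , ε)
  upper : D w ℤ.≤ + 0
  upper = D-antitone oneTree w (s≤s z≤n) (w-max oneTree ([] , refl , refl ∷ []) oneTree-leaves)
  lower : + 0 ℤ.≤ D w
  lower = subst (+ 0 ℤ.≤_) (sym (D≡boundaries w w≢∅)) (ℤ.+≤+ z≤n)

mainTheorem5 : (n : ℕ) → 1 ≤ n →
    ((u : Triple) → IsMinFn n u → D u ≡ + n - + 1)
    × ((w : Triple) → IsMaxFn n w → D w ≡ + 0)
    × ((F : Triple) → leaves F ≡ n → (u w : Triple) → IsMinOf F u → IsMaxOf F w →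
         (+ dim F - + 1) Data.Integer.≤ (D u - D w))
mainTheorem5 n 1≤n =
  D-min n 1≤n ,
  D-max n 1≤n ,
  λ F F-leaves → D-dimension-bound F (subst (1 ≤_) (sym F-leaves) 1≤n)
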